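{- Let $n\ge1$ and let $\mathcal{C}_n$ be the set of corner-sum hypermatrices of order $n$, partially ordered by entrywise comparison. Then $\mathcal{C}_n$ is a distributive lattice.
   Context: A corner-sum hypermatrix of order $n$ is an $(n+1)\times(n+1)\times(n+1)$ integer array $C=(C_{i,j,k})$ with indices $i,j,k\in[0,n]=\{0,1,\dots,n\}$ such that for all $i,j\in[0,n]$: $C_{i,j,0}=C_{i,0,j}=C_{0,i,j}=0$ and $C_{i,j,n}=C_{i,n,j}=C_{n,i,j}=ij$; and for all $i,j\in[0,n]$ and $1\le k\le n$, each of the three differences $C_{i,j,k}-C_{i,j,k-1}$, $C_{i,k,j}-C_{i,k-1,j}$, $C_{k,i,j}-C_{k-1,i,j}$ lies in $\{\max(0,i+j-n),\dots,\min(i,j)\}$. Entrywise comparison: $C\ge D$ iff $C_{i,j,k}\ge D_{i,j,k}$ for all indices (the paper orders $\mathcal{C}_n$ so that $C$ precedes $D$ iff $C\ge D$; distributivity does not depend on which of the two dual orders is used). -}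

module Defs where

open import Data.Nat as ℕ using (ℕ; suc; _⊓_; _∸_)
open import Data.Integer as ℤ using (ℤ; +_; _-_; _*_)
open import Data.Fin using (Fin; toℕ; inject₁; zero; fromℕ) renaming (suc to fsuc)
open import Data.Product using (Σ; _×_; proj₁)
open import Level using (0ℓ)
open import Relation.Binary.Core using (Rel)
open import Relation.Binary.PropositionalEquality using (_≡_)

Array : ℕ → Set
Array n = Fin (suc n) → Fin (suc n) → Fin (suc n) → ℤ

-- The allowed range for a difference at position (i,j):
-- max(0, i+j-n) ≤ d ≤ min(i,j).  (In ℕ, i + j ∸ n = max(0, i+j-n).)
InRange : (n : ℕ) → Fin (suc n) → Fin (suc n) → ℤ → Set
InRange n i j d = (+ (toℕ i ℕ.+ toℕ j ∸ n) ℤ.≤ d) × (d ℤ.≤ + (toℕ i ⊓ toℕ j))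

-- Corner-sum hypermatrix of order n.  For k : Fin n, the index k in [1,n]
-- is `suc k` and k-1 is `inject₁ k`.
record IsCornerSum (n : ℕ) (C : Array n) : Set where
  field
    zero₃ : ∀ i j → C i j zero ≡ + 0
    zero₂ : ∀ i j → C i zero j ≡ + 0
    zero₁ : ∀ i j → C zero i j ≡ + 0
    full₃ : ∀ i j → C i j (fromℕ n) ≡ + (toℕ i ℕ.* toℕ j)
    full₂ : ∀ i j → C i (fromℕ n) j ≡ + (toℕ i ℕ.* toℕ j)
    full₁ : ∀ i j → C (fromℕ n) i j ≡ + (toℕ i ℕ.* toℕ j)
    diff₃ : ∀ i j (k : Fin n) → InRange n i j (C i j (fsuc k) - C i j (inject₁ k))
    diff₂ : ∀ i j (k : Fin n) → InRange n i j (C i (fsuc k) j - C i (inject₁ k) j)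
    diff₁ : ∀ i j (k : Fin n) → InRange n i j (C (fsuc k) i j - C (inject₁ k) i j)

CornerSum : ℕ → Set
CornerSum n = Σ (Array n) (IsCornerSum n)

_≈ᶜ_ : ∀ {n} → Rel (CornerSum n) 0ℓ
C ≈ᶜ D = ∀ i j k → proj₁ C i j k ≡ proj₁ D i j k

_≤ᶜ_ : ∀ {n} → Rel (CornerSum n) 0ℓ
C ≤ᶜ D = ∀ i j k → proj₁ C i j k ℤ.≤ proj₁ D i j k

-- The defining conditions of a corner-sum hypermatrix fix its boundary values and confine
-- each difference of neighbouring entries to an interval [a, b].  Since translation by a
-- constant commutes with max and min, a ≤ x′ − x ≤ b and a ≤ y′ − y ≤ b (read as
-- a + x ≤ x′ ≤ b + x, and likewise for y) give a ≤ (x′ ∙ y′) − (x ∙ y) ≤ b for ∙ = ⊔, ⊓.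
-- So 𝒞ₙ is closed under entrywise max and min: it is a sublattice of the distributive
-- lattice of all integer arrays under the entrywise order.
module Submission where

open import Defs
open import Algebra.Bundles using (AbelianGroup)
open import Algebra.Core using (Op₂)
open import Data.Fin using (inject₁) renaming (suc to fsuc)
open import Data.Integer using (ℤ; _+_; -_; _-_; _≤_; _⊔_; _⊓_)
import Data.Integer.Properties as ℤ
open import Data.Nat as ℕ using (ℕ)
open import Data.Product using (Σ-syntax; _×_; _,_; proj₁)
open import Relation.Binary.Core using (_Preserves₂_⟶_⟶_)
open import Relation.Binary.Lattice.Structures using (IsDistributiveLattice; IsLattice)
open import Relation.Binary.PropositionalEquality
open import Relation.Binary.Structures using (IsPartialOrder)

open import Algebra.Definitions (_≡_ {A = ℤ}) using (Idempotent; _DistributesOverˡ_)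

open import Algebra.Properties.Group (AbelianGroup.group ℤ.+-0-abelianGroup)
  using (//-rightDividesˡ; //-rightDividesʳ)

i≤j-k⇒i+k≤j : ∀ {i j k} → i ≤ j - k → i + k ≤ j
i≤j-k⇒i+k≤j {i} {j} {k} p = subst (i + k ≤_) (//-rightDividesˡ k j) (ℤ.+-monoˡ-≤ k p)

i+k≤j⇒i≤j-k : ∀ {i j k} → i + k ≤ j → i ≤ j - k
i+k≤j⇒i≤j-k {i} {j} {k} p = subst (_≤ j - k) (//-rightDividesʳ k i) (ℤ.+-monoˡ-≤ (- k) p)

i-k≤j⇒i≤j+k : ∀ {i j k} → i - k ≤ j → i ≤ j + k
i-k≤j⇒i≤j+k {i} {j} {k} p = subst (_≤ j + k) (//-rightDividesˡ k i) (ℤ.+-monoˡ-≤ k p)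

i≤j+k⇒i-k≤j : ∀ {i j k} → i ≤ j + k → i - k ≤ j
i≤j+k⇒i-k≤j {i} {j} {k} p = subst (i - k ≤_) (//-rightDividesʳ k j) (ℤ.+-monoˡ-≤ (- k) p)

Between : ℤ → ℤ → ℤ → Set
Between a b d = a ≤ d × d ≤ b

+-distribˡ-⊔ : _+_ DistributesOverˡ _⊔_
+-distribˡ-⊔ c = ℤ.mono-≤-distrib-⊔ (ℤ.+-monoʳ-≤ c)

+-distribˡ-⊓ : _+_ DistributesOverˡ _⊓_
+-distribˡ-⊓ c = ℤ.mono-≤-distrib-⊓ (ℤ.+-monoʳ-≤ c)

module TranslationEquivariant
  (_∙_ : Op₂ ℤ)
  (∙-idem : Idempotent _∙_)
  (∙-mono-≤ : _∙_ Preserves₂ _≤_ ⟶ _≤_ ⟶ _≤_)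
  (+-distribˡ-∙ : _+_ DistributesOverˡ _∙_)
  where

  ∙-fixes : ∀ {x y z} → x ≡ z → y ≡ z → x ∙ y ≡ z
  ∙-fixes {z = z} refl refl = ∙-idem z

  ∙-preserves-Between-diff : ∀ {a b x x′ y y′} →
    Between a b (x′ - x) → Between a b (y′ - y) → Between a b ((x′ ∙ y′) - (x ∙ y))
  ∙-preserves-Between-diff {a} {b} {x} {x′} {y} {y′} (a≤dx , dx≤b) (a≤dy , dy≤b) =
    i+k≤j⇒i≤j-k (subst (_≤ x′ ∙ y′) (sym (+-distribˡ-∙ a x y))
      (∙-mono-≤ (i≤j-k⇒i+k≤j a≤dx) (i≤j-k⇒i+k≤j a≤dy))) ,
    i≤j+k⇒i-k≤j (subst (x′ ∙ y′ ≤_) (sym (+-distribˡ-∙ b x y))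
      (∙-mono-≤ (i-k≤j⇒i≤j+k dx≤b) (i-k≤j⇒i≤j+k dy≤b)))

  pointwise : ∀ {n} → Op₂ (CornerSum n)
  pointwise (C , c) (D , d) = (λ i j k → C i j k ∙ D i j k) , record
    { zero₃ = λ i j → ∙-fixes (zero₃ c i j) (zero₃ d i j)
    ; zero₂ = λ i j → ∙-fixes (zero₂ c i j) (zero₂ d i j)
    ; zero₁ = λ i j → ∙-fixes (zero₁ c i j) (zero₁ d i j)
    ; full₃ = λ i j → ∙-fixes (full₃ c i j) (full₃ d i j)
    ; full₂ = λ i j → ∙-fixes (full₂ c i j) (full₂ d i j)
    ; full₁ = λ i j → ∙-fixes (full₁ c i j) (full₁ d i j)
    ; diff₃ = λ i j k → ∙-preserves-Between-diff (diff₃ c i j k) (diff₃ d i j k)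
    ; diff₂ = λ i j k → ∙-preserves-Between-diff (diff₂ c i j k) (diff₂ d i j k)
    ; diff₁ = λ i j k → ∙-preserves-Between-diff (diff₁ c i j k) (diff₁ d i j k)
    }
    where open IsCornerSum

_∨ᶜ_ : ∀ {n} → Op₂ (CornerSum n)
_∨ᶜ_ = TranslationEquivariant.pointwise _⊔_ ℤ.⊔-idem ℤ.⊔-mono-≤ +-distribˡ-⊔

_∧ᶜ_ : ∀ {n} → Op₂ (CornerSum n)
_∧ᶜ_ = TranslationEquivariant.pointwise _⊓_ ℤ.⊓-idem ℤ.⊓-mono-≤ +-distribˡ-⊓

module _ {n : ℕ} where

  ≤ᶜ-isPartialOrder : IsPartialOrder (_≈ᶜ_ {n}) _≤ᶜ_
  ≤ᶜ-isPartialOrder = record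
    { isPreorder = record
      { isEquivalence = record
        { refl = λ i j k → refl
        ; sym = λ C≈D i j k → sym (C≈D i j k)
        ; trans = λ C≈D D≈E i j k → trans (C≈D i j k) (D≈E i j k)
        }
      ; reflexive = λ C≈D i j k → ℤ.≤-reflexive (C≈D i j k)
      ; trans = λ C≤D D≤E i j k → ℤ.≤-trans (C≤D i j k) (D≤E i j k)
      }
    ; antisym = λ C≤D D≤C i j k → ℤ.≤-antisym (C≤D i j k) (D≤C i j k)
    }

  ≤ᶜ-isLattice : IsLattice (_≈ᶜ_ {n}) _≤ᶜ_ _∨ᶜ_ _∧ᶜ_
  ≤ᶜ-isLattice = record
    { isPartialOrder = ≤ᶜ-isPartialOrder
    ; supremum = λ C D →
        (λ i j k → ℤ.i≤i⊔j _ _) , (λ i j k → ℤ.i≤j⊔i _ _) ,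
        (λ E C≤E D≤E i j k → ℤ.⊔-lub (C≤E i j k) (D≤E i j k))
    ; infimum = λ C D →
        (λ i j k → ℤ.i⊓j≤i _ _) , (λ i j k → ℤ.i⊓j≤j _ _) ,
        (λ E E≤C E≤D i j k → ℤ.⊓-glb (E≤C i j k) (E≤D i j k))
    }

  ≤ᶜ-isDistributiveLattice : IsDistributiveLattice (_≈ᶜ_ {n}) _≤ᶜ_ _∨ᶜ_ _∧ᶜ_
  ≤ᶜ-isDistributiveLattice = record
    { isLattice = ≤ᶜ-isLattice
    ; ∧-distribˡ-∨ = λ C D E i j k →
        ℤ.⊓-distribˡ-⊔ (proj₁ C i j k) (proj₁ D i j k) (proj₁ E i j k)
    }

mainTheorem2 : (n : ℕ) → 1 ℕ.≤ n →
    Σ[ join ∈ Op₂ (CornerSum n) ] Σ[ meet ∈ Op₂ (CornerSum n) ]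
      IsDistributiveLattice (_≈ᶜ_ {n}) (_≤ᶜ_ {n}) join meet
mainTheorem2 n _ = _∨ᶜ_ , _∧ᶜ_ , ≤ᶜ-isDistributiveLattice
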